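{- For any finite simple graph $G$ with at least one vertex, $AT(G,-)=\left\lceil \frac{\mathrm{mad}(G)}{2}\right\rceil+1$.
   Context: $(G,-)$ denotes the signed graph on $G$ in which every edge has sign $-1$. For a signed graph $(G,\sigma)$ (with $\sigma\colon E(G)\to\{+1,-1\}$) and a fixed linear ordering $<$ of $V(G)$, the graph polynomial is $P_{G,\sigma}(\mathbf{x})=\prod_{uv\in E(G),\,u<v}(x_u-\sigma(uv)x_v)$ and $AT(G,\sigma)$ is the minimum $k$ such that the expansion of $P_{G,\sigma}(\mathbf{x})$ contains a monomial $c\prod_v x_v^{t_v}$ with $c\neq0$ and $t_v<k$ for all $v$. The maximum average degree $\mathrm{mad}(G)$ is the maximum of $2|E(H)|/|V(H)|$ over all subgraphs $H$ of $G$ with at least one vertex. -}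

module Defs where

open import Data.Bool using (Bool; true; false; _∧_; if_then_else_)
open import Data.Nat as ℕ using (ℕ; zero; suc)
open import Data.Fin as Fin using (Fin)
open import Data.Vec as Vec using (Vec; []; _∷_)
open import Data.List as List using (List; []; _∷_; _++_)
open import Data.Product using (_×_; _,_; ∃-syntax; proj₁; proj₂)
open import Data.Integer as ℤ using (ℤ)
open import Data.Sign as Sign using (Sign)
open import Data.Rational as ℚ using (ℚ)
open import Data.Vec.Properties using (≡-dec)
open import Relation.Nullary using (¬_; does)
open import Relation.Binary.PropositionalEquality using (_≡_)

-- Finite simple graphs on the vertex set Fin n
-- (the fixed linear ordering of V(G) is the natural order on Fin n)

record SimpleGraph (n : ℕ) : Set where
  field
    adj    : Fin n → Fin n → Bool
    sym    : ∀ u v → adj u v ≡ adj v u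
    irrefl : ∀ u → adj u u ≡ false

open SimpleGraph public

edges : ∀ {n} → SimpleGraph n → List (Fin n × Fin n)
edges {n} G =
  List.filterᵇ (λ e → does (Fin._<?_ (proj₁ e) (proj₂ e))
                      ∧ adj G (proj₁ e) (proj₂ e))
               (List.cartesianProduct (List.allFin n) (List.allFin n))

-- Signed graphs: a signature assigns a sign to each edge
-- (given as a function on ordered vertex pairs; only its values on
-- edges (u , v) with u < v are used).

Signature : ℕ → Set
Signature n = Fin n → Fin n → Sign

allNegative : ∀ {n} → Signature n
allNegative _ _ = Sign.-

signℤ : Sign → ℤ
signℤ Sign.+ = ℤ.1ℤ
signℤ Sign.- = ℤ.-1ℤ

-- Polynomials in x_0 … x_{n-1} with integer coefficients, as formal
-- sums of terms  c · x^t  (t an exponent vector).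

Monomial : ℕ → Set
Monomial n = Vec ℕ n

Poly : ℕ → Set
Poly n = List (ℤ × Monomial n)

unitMono : ∀ {n} → Fin n → Monomial n
unitMono {n} i = Vec.tabulate (λ j → if does (i Fin.≟ j) then 1 else 0)

onePoly : ∀ {n} → Poly n
onePoly {n} = (ℤ.1ℤ , Vec.replicate n 0) ∷ []

_*P_ : ∀ {n} → Poly n → Poly n → Poly n
p *P q = List.cartesianProductWith
           (λ { (a , s) (b , t) → (a ℤ.* b , Vec.zipWith ℕ._+_ s t) }) p q

coeff : ∀ {n} → Poly n → Monomial n → ℤ
coeff p t = List.foldr ℤ._+_ ℤ.0ℤ
  (List.map (λ { (c , s) → if does (≡-dec ℕ._≟_ s t) then c else ℤ.0ℤ }) p)

graphPoly : ∀ {n} → SimpleGraph n → Signature n → Poly n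
graphPoly G σ =
  List.foldr (λ { (u , v) acc →
                 ((ℤ.1ℤ , unitMono u) ∷ (ℤ.- signℤ (σ u v) , unitMono v) ∷ []) *P acc })
             onePoly (edges G)

HasATMonomial : ∀ {n} → SimpleGraph n → Signature n → ℕ → Set
HasATMonomial {n} G σ k =
  ∃[ t ] (¬ (coeff (graphPoly G σ) t ≡ ℤ.0ℤ) × (∀ (v : Fin n) → Vec.lookup t v ℕ.< k))

IsAT : ∀ {n} → SimpleGraph n → Signature n → ℕ → Set
IsAT G σ k = HasATMonomial G σ k × (∀ j → j ℕ.< k → ¬ HasATMonomial G σ j)

allSubsets : (m : ℕ) → List (Vec Bool m)
allSubsets zero    = [] ∷ []
allSubsets (suc m) = List.map (true ∷_) (allSubsets m) ++ List.map (false ∷_) (allSubsets m)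

countTrue : ∀ {m} → Vec Bool m → ℕ
countTrue []          = 0
countTrue (true ∷ b)  = suc (countTrue b)
countTrue (false ∷ b) = countTrue b

selected : ∀ {A : Set} (l : List A) → Vec Bool (List.length l) → List A
selected []       []          = []
selected (x ∷ xs) (true ∷ b)  = x ∷ selected xs b
selected (x ∷ xs) (false ∷ b) = selected xs b

isSubgraph : ∀ {n} (G : SimpleGraph n) → Vec Bool n → Vec Bool (List.length (edges G)) → Bool
isSubgraph G S F =
  List.foldr _∧_ true
    (List.map (λ { (u , v) → Vec.lookup S u ∧ Vec.lookup S v }) (selected (edges G) F))

avgDeg : ℕ → ℕ → ℚ
avgDeg e zero    = ℚ.0ℚ
avgDeg e (suc s) = ℤ.+ (2 ℕ.* e) ℚ./ suc s

avgDegrees : ∀ {n} → SimpleGraph n → List ℚ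
avgDegrees {n} G =
  List.concatMap
    (λ S → if 0 ℕ.<ᵇ countTrue S
           then List.map (λ F → avgDeg (List.length (selected (edges G) F)) (countTrue S))
                         (List.filterᵇ (isSubgraph G S) (allSubsets (List.length (edges G))))
           else [])
    (allSubsets n)

-- mad(G) = maximum of that list (for n ≥ 1 the list is nonempty and all
-- values are ≥ 0, so starting the fold at 0 is harmless)
mad : ∀ {n} → SimpleGraph n → ℚ
mad G = List.foldr ℚ._⊔_ ℚ.0ℚ (avgDegrees G)

module Submission where

open import Defs hiding (sym)
open import Data.Bool using (Bool; true; false; _∧_; if_then_else_; T)
open import Data.Bool.Properties using (T-≡; T-∧)
open import Data.Nat as ℕ using (ℕ; zero; suc; _≤_; _<_; _∸_; z≤n; s≤s)
import Data.Nat.Properties as ℕ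
open import Data.Nat.Induction using (<-wellFounded)
open import Data.Nat.Tactic.RingSolver using (solve-∀)
import Data.Nat.Coprimality as Coprimality
open import Data.Integer as ℤ using (ℤ; +_; _+_; 0ℤ; 1ℤ)
import Data.Integer.Properties as ℤ
import Data.Integer.DivMod as ℤ
open import Data.Rational as ℚ using (ℚ; mkℚ; ↥_; ↧_; 0ℚ; _⊔_; floor; ceiling; _*_; ½)
import Data.Rational.Properties as ℚ
import Data.Rational.Unnormalised as ℚᵘ
import Data.Rational.Unnormalised.Properties as ℚᵘ
open import Data.Fin as Fin using (Fin)
open import Data.Fin.Subset using (Subset; inside; outside; _∈_; _∉_; _⊆_; ∣_∣; _∪_; ⁅_⁆)
open import Data.Fin.Subset.Properties
  using (_∈?_; p⊆p∪q; x∈p∪q⁺; x∈p∪q⁻; x∈⁅x⁆; x∈⁅y⁆⇒x≡y; p⊂q⇒∣p∣<∣q∣; ∣p∣≤n; x∈p⇒∣p-x∣<∣p∣)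
open import Data.Vec as Vec using (Vec; []; _∷_; lookup; here; there)
import Data.Vec.Properties as Vec
open import Data.List as List using (List; []; _∷_; _++_; map; length; filter)
import Data.List.Properties as List
open import Data.List.Relation.Binary.Pointwise as Pointwise using (Pointwise; []; _∷_)
open import Data.List.Relation.Unary.Any as Any using (Any)
open import Data.List.Relation.Unary.All as All using (All; []; _∷_)
import Data.List.Relation.Unary.All.Properties as All
open import Data.List.Membership.Propositional using (find; lose) renaming (_∈_ to _∈ₗ_)
open import Data.List.Membership.Propositional.Properties
  using (∈-map⁺; ∈-map⁻; ∈-++⁺ˡ; ∈-++⁺ʳ; ∈-++⁻; ∈-concatMap⁺; ∈-concatMap⁻; ∈-filter⁺; ∈-filter⁻)
open import Data.Product as Product using (_×_; _,_; ∃-syntax; proj₁; proj₂; swap)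
open import Data.Product.Function.NonDependent.Propositional using (_×-⇔_)
open import Data.Sum as Sum using (_⊎_; inj₁; inj₂)
open import Function using (_∘_; _⇔_; mk⇔; Equivalence)
open import Function.Properties.Equivalence using () renaming (trans to ⇔-trans; sym to ⇔-sym)
open import Induction.WellFounded using (Acc; acc)
open import Relation.Nullary using (¬_; Dec; does; yes; no; contradiction)
open import Relation.Nullary.Decidable using (_×-dec_; ¬?; T?; dec-true; dec-false)
open import Relation.Binary.PropositionalEquality
open import Algebra.Properties.CommutativeSemigroup ℕ.+-commutativeSemigroup
  using (interchange; xy∙z≈xz∙y; xy∙z≈zy∙x)

-- For the all-negative signature every factor of the graph polynomial is x_u + x_v, so
-- its expansion is the sum, over all orientations of G, of x^(outdegree vector), each
-- with coefficient +1.  Nothing cancels, hence AT(G,-) - 1 is the least c such that G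
-- has an orientation of maximum outdegree at most c.  By Hakimi's theorem such an
-- orientation exists iff every vertex set S spans at most c|S| edges, that is iff
-- mad(G) ≤ 2c, that is iff ⌈mad(G)/2⌉ ≤ c.
-- Hakimi's theorem is proved by inserting the edges one at a time.  When a new edge
-- overloads its tail x, grow the set R of vertices reachable from x by directed paths:
-- either some reachable vertex has spare capacity and reversing the path to it restores
-- the bound, or R is closed and saturated and then spans more than c|R| edges.

private variable n : ℕ

-- Orientations and outdegrees

Edge : ℕ → Set
Edge n = Fin n × Fin n

Orientation : List (Edge n) → List (Edge n) → Set
Orientation = Pointwise (λ e f → f ≡ e ⊎ f ≡ swap e)

δ : Fin n → Fin n → ℕ
δ u v = if does (u Fin.≟ v) then 1 else 0

δ-refl : (v : Fin n) → δ v v ≡ 1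
δ-refl v = cong (λ b → if b then 1 else 0) (dec-true (v Fin.≟ v) refl)

δ-≢ : {u v : Fin n} → u ≢ v → δ u v ≡ 0
δ-≢ {u = u} {v} u≢v = cong (λ b → if b then 1 else 0) (dec-false (u Fin.≟ v) u≢v)

outdeg : List (Edge n) → Fin n → ℕ
outdeg []             v = 0
outdeg ((t , _) ∷ fs) v = δ t v ℕ.+ outdeg fs v

Orientable : ℕ → List (Edge n) → Set
Orientable c es = ∃[ fs ] (Orientation es fs × ∀ v → outdeg fs v ≤ c)

-- The graph polynomial of (G,-)

orientations : List (Edge n) → List (List (Edge n))
orientations []       = [] ∷ []
orientations (e ∷ es) = map (e ∷_) (orientations es) ++ map (swap e ∷_) (orientations es)

∈-orientations⁺ : {es fs : List (Edge n)} → Orientation es fs → fs ∈ₗ orientations es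
∈-orientations⁺ []              = Any.here refl
∈-orientations⁺ (inj₁ refl ∷ o) = ∈-++⁺ˡ (∈-map⁺ _ (∈-orientations⁺ o))
∈-orientations⁺ {es = e ∷ es} (inj₂ refl ∷ o) =
  ∈-++⁺ʳ (map (e ∷_) (orientations es)) (∈-map⁺ _ (∈-orientations⁺ o))

∈-orientations⁻ : (es : List (Edge n)) {fs : List (Edge n)} → fs ∈ₗ orientations es → Orientation es fs
∈-orientations⁻ []       (Any.here refl) = []
∈-orientations⁻ (e ∷ es) fs∈ with ∈-++⁻ (map (e ∷_) (orientations es)) fs∈
... | inj₁ fs∈₁ with _ , gs∈ , refl ← ∈-map⁻ _ fs∈₁ = inj₁ refl ∷ ∈-orientations⁻ es gs∈
... | inj₂ fs∈₂ with _ , gs∈ , refl ← ∈-map⁻ _ fs∈₂ = inj₂ refl ∷ ∈-orientations⁻ es gs∈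

outdegrees : List (Edge n) → Monomial n
outdegrees []             = Vec.replicate _ 0
outdegrees ((t , _) ∷ fs) = Vec.zipWith ℕ._+_ (unitMono t) (outdegrees fs)

lookup-outdegrees : (fs : List (Edge n)) (v : Fin n) → lookup (outdegrees fs) v ≡ outdeg fs v
lookup-outdegrees []             v = Vec.lookup-replicate v 0
lookup-outdegrees ((t , _) ∷ fs) v = begin
  lookup (Vec.zipWith ℕ._+_ (unitMono t) (outdegrees fs)) v
    ≡⟨ Vec.lookup-zipWith ℕ._+_ v (unitMono t) (outdegrees fs) ⟩
  lookup (unitMono t) v ℕ.+ lookup (outdegrees fs) v
    ≡⟨ cong₂ ℕ._+_ (Vec.lookup∘tabulate (δ t) v) (lookup-outdegrees fs v) ⟩
  δ t v ℕ.+ outdeg fs v ∎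
  where open ≡-Reasoning

orientationTerm : List (Edge n) → ℤ × Monomial n
orientationTerm fs = 1ℤ , outdegrees fs

mulEdgeFactor : Edge n → Poly n → Poly n
mulEdgeFactor (u , v) p = ((1ℤ , unitMono u) ∷ (1ℤ , unitMono v) ∷ []) *P p

edgeProduct : List (Edge n) → Poly n
edgeProduct = List.foldr mulEdgeFactor onePoly

edgeProduct-expansion : (es : List (Edge n)) → edgeProduct es ≡ map orientationTerm (orientations es)
edgeProduct-expansion []             = refl
edgeProduct-expansion ((u , v) ∷ es) = begin
  mulEdgeFactor (u , v) (edgeProduct es)
    ≡⟨ cong (mulEdgeFactor (u , v)) (edgeProduct-expansion es) ⟩
  mulEdgeFactor (u , v) (map orientationTerm os)
    ≡⟨ cong₂ _++_ (sym (List.map-∘ os)) (trans (List.++-identityʳ _) (sym (List.map-∘ os))) ⟩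
  map (orientationTerm ∘ ((u , v) ∷_)) os ++ map (orientationTerm ∘ ((v , u) ∷_)) os
    ≡⟨ cong₂ _++_ (List.map-∘ os) (List.map-∘ os) ⟩
  map orientationTerm (map ((u , v) ∷_) os) ++ map orientationTerm (map ((v , u) ∷_) os)
    ≡⟨ List.map-++ orientationTerm (map ((u , v) ∷_) os) _ ⟨
  map orientationTerm (orientations ((u , v) ∷ es)) ∎
  where
  open ≡-Reasoning
  os = orientations es

-- graphPoly G allNegative is edgeProduct (edges G) by computation: x_u - (-1) x_v = x_u + x_v.
graphPoly-allNegative : (G : SimpleGraph n) →
  graphPoly G allNegative ≡ map orientationTerm (orientations (edges G))
graphPoly-allNegative G = edgeProduct-expansion (edges G)

_≟ₘ_ : (s t : Monomial n) → Dec (s ≡ t)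
_≟ₘ_ = Vec.≡-dec ℕ._≟_

coeff-map-ones : {A : Set} (m : A → Monomial n) (xs : List A) (t : Monomial n) →
  coeff (map (λ x → 1ℤ , m x) xs) t ≡ + length (filter (λ x → m x ≟ₘ t) xs)
coeff-map-ones m []       t = refl
coeff-map-ones m (x ∷ xs) t with m x ≟ₘ t
... | yes _ = cong (_+_ 1ℤ) (coeff-map-ones m xs t)
... | no  _ = trans (ℤ.+-identityˡ _) (coeff-map-ones m xs t)

coeff-map-ones≢0⇔Any : {A : Set} (m : A → Monomial n) (xs : List A) (t : Monomial n) →
  (coeff (map (λ x → 1ℤ , m x) xs) t ≢ 0ℤ) ⇔ Any (λ x → m x ≡ t) xs
coeff-map-ones≢0⇔Any m xs t = mk⇔ nonzero⇒Any Any⇒nonzero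
  where
  P? = λ x → m x ≟ₘ t
  coeff≢0⇔count≢0 : (coeff (map (λ x → 1ℤ , m x) xs) t ≢ 0ℤ) ⇔ (length (filter P? xs) ≢ 0)
  coeff≢0⇔count≢0 rewrite coeff-map-ones m xs t =
    mk⇔ (λ ≢0 ≡0 → ≢0 (cong +_ ≡0)) (λ ≢0 ≡0 → ≢0 (ℤ.+-injective ≡0))
  nonzero⇒Any : coeff (map (λ x → 1ℤ , m x) xs) t ≢ 0ℤ → Any (λ x → m x ≡ t) xs
  nonzero⇒Any ≢0 with Any.any? P? xs
  ... | yes any  = any
  ... | no  ¬any = contradiction (cong length (List.filter-none P? (All.¬Any⇒All¬ xs ¬any)))
                                 (Equivalence.to coeff≢0⇔count≢0 ≢0)
  Any⇒nonzero : Any (λ x → m x ≡ t) xs → coeff (map (λ x → 1ℤ , m x) xs) t ≢ 0ℤ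
  Any⇒nonzero any = Equivalence.from coeff≢0⇔count≢0 (ℕ.n>0⇒n≢0 (List.filter-some P? any))

orientable⇔hasATMonomial : (G : SimpleGraph n) (c : ℕ) →
  Orientable c (edges G) ⇔ HasATMonomial G allNegative (suc c)
orientable⇔hasATMonomial G c = mk⇔ orientable⇒hasAT hasAT⇒orientable
  where
  os = orientations (edges G)
  coeff≢0⇔ : ∀ t → (coeff (graphPoly G allNegative) t ≢ 0ℤ) ⇔ Any (λ fs → outdegrees fs ≡ t) os
  coeff≢0⇔ t rewrite graphPoly-allNegative G = coeff-map-ones≢0⇔Any outdegrees os t
  orientable⇒hasAT : Orientable c (edges G) → HasATMonomial G allNegative (suc c)
  orientable⇒hasAT (fs , o , bounded) =
      outdegrees fs
    , Equivalence.from (coeff≢0⇔ (outdegrees fs))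
                       (Any.map (λ eq → cong outdegrees (sym eq)) (∈-orientations⁺ o))
    , λ v → subst (_< suc c) (sym (lookup-outdegrees fs v)) (s≤s (bounded v))
  hasAT⇒orientable : HasATMonomial G allNegative (suc c) → Orientable c (edges G)
  hasAT⇒orientable (t , ≢0 , bounded) with fs , fs∈ , refl ← find (Equivalence.to (coeff≢0⇔ t) ≢0) =
    fs , ∈-orientations⁻ (edges G) fs∈ ,
    λ v → ℕ.≤-pred (subst (_< suc c) (lookup-outdegrees fs v) (bounded v))

¬hasATMonomial-zero : (G : SimpleGraph (suc n)) (σ : Signature (suc n)) → ¬ HasATMonomial G σ 0
¬hasATMonomial-zero G σ (_ , _ , bounded) = ℕ.n≮0 (bounded Fin.zero)

-- Counting edges inside a vertex set

module _ {A : Set} {P : A → Set} (P? : (x : A) → Dec (P x)) where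

  length-filter-∷ : (x : A) (xs : List A) → length (filter P? xs) ≤ length (filter P? (x ∷ xs))
  length-filter-∷ x xs with does (P? x)
  ... | true  = ℕ.n≤1+n _
  ... | false = ℕ.≤-refl

  indicator : (xs : List A) → Vec Bool (length xs)
  indicator []       = []
  indicator (x ∷ xs) = does (P? x) ∷ indicator xs

  selected-indicator : (xs : List A) → selected xs (indicator xs) ≡ filter P? xs
  selected-indicator []       = refl
  selected-indicator (x ∷ xs) with does (P? x)
  ... | true  = cong (x ∷_) (selected-indicator xs)
  ... | false = selected-indicator xs

  length-selected≤ : (xs : List A) (F : Vec Bool (length xs)) →
    All P (selected xs F) → length (selected xs F) ≤ length (filter P? xs)
  length-selected≤ []       []          _          = z≤n
  length-selected≤ (x ∷ xs) (false ∷ F) all        =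
    ℕ.≤-trans (length-selected≤ xs F all) (length-filter-∷ x xs)
  length-selected≤ (x ∷ xs) (true  ∷ F) (px ∷ all) rewrite dec-true (P? x) px =
    s≤s (length-selected≤ xs F all)

∑∈ : Subset n → (Fin n → ℕ) → ℕ
∑∈ []            f = 0
∑∈ (inside  ∷ S) f = f Fin.zero ℕ.+ ∑∈ S (f ∘ Fin.suc)
∑∈ (outside ∷ S) f = ∑∈ S (f ∘ Fin.suc)

∑∈-const : (S : Subset n) (c : ℕ) → ∑∈ S (λ _ → c) ≡ c ℕ.* ∣ S ∣
∑∈-const []            c = sym (ℕ.*-zeroʳ c)
∑∈-const (inside  ∷ S) c = trans (cong (c ℕ.+_) (∑∈-const S c)) (sym (ℕ.*-suc c ∣ S ∣))
∑∈-const (outside ∷ S) c = ∑∈-const S c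

∑∈-+ : (S : Subset n) (f g : Fin n → ℕ) → ∑∈ S (λ v → f v ℕ.+ g v) ≡ ∑∈ S f ℕ.+ ∑∈ S g
∑∈-+ []            f g = refl
∑∈-+ (inside  ∷ S) f g =
  trans (cong (f Fin.zero ℕ.+ g Fin.zero ℕ.+_) (∑∈-+ S (f ∘ Fin.suc) (g ∘ Fin.suc)))
        (interchange (f Fin.zero) (g Fin.zero) _ _)
∑∈-+ (outside ∷ S) f g = ∑∈-+ S (f ∘ Fin.suc) (g ∘ Fin.suc)

∑∈-δ-∈ : {S : Subset n} {t : Fin n} → t ∈ S → ∑∈ S (δ t) ≡ 1
∑∈-δ-∈ {S = inside  ∷ S} here        = cong suc (∑∈-const S 0)
∑∈-δ-∈ {S = inside  ∷ S} (there t∈S) = ∑∈-δ-∈ t∈S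
∑∈-δ-∈ {S = outside ∷ S} (there t∈S) = ∑∈-δ-∈ t∈S

∑∈-δ-∉ : {S : Subset n} {t : Fin n} → t ∉ S → ∑∈ S (δ t) ≡ 0
∑∈-δ-∉ {S = inside  ∷ S} {Fin.zero}  t∉S = contradiction here t∉S
∑∈-δ-∉ {S = outside ∷ S} {Fin.zero}  t∉S = ∑∈-const S 0
∑∈-δ-∉ {S = inside  ∷ S} {Fin.suc t} t∉S = ∑∈-δ-∉ (t∉S ∘ there)
∑∈-δ-∉ {S = outside ∷ S} {Fin.suc t} t∉S = ∑∈-δ-∉ (t∉S ∘ there)

∑∈-mono : (S : Subset n) {f g : Fin n → ℕ} → (∀ {v} → v ∈ S → f v ≤ g v) → ∑∈ S f ≤ ∑∈ S g
∑∈-mono []            f≤g = z≤n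
∑∈-mono (inside  ∷ S) f≤g = ℕ.+-mono-≤ (f≤g here) (∑∈-mono S (f≤g ∘ there))
∑∈-mono (outside ∷ S) f≤g = ∑∈-mono S (f≤g ∘ there)

∑∈-mono-< : {S : Subset n} {f g : Fin n → ℕ} {x : Fin n} →
  (∀ {v} → v ∈ S → f v ≤ g v) → x ∈ S → f x < g x → ∑∈ S f < ∑∈ S g
∑∈-mono-< {S = inside  ∷ S} f≤g here        fx<gx = ℕ.+-mono-<-≤ fx<gx (∑∈-mono S (f≤g ∘ there))
∑∈-mono-< {S = inside  ∷ S} f≤g (there x∈S) fx<gx =
  ℕ.+-mono-≤-< (f≤g here) (∑∈-mono-< (f≤g ∘ there) x∈S fx<gx)
∑∈-mono-< {S = outside ∷ S} f≤g (there x∈S) fx<gx = ∑∈-mono-< (f≤g ∘ there) x∈S fx<gx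

EdgeWithin : Subset n → Edge n → Set
EdgeWithin S (u , v) = u ∈ S × v ∈ S

edgeWithin? : (S : Subset n) (e : Edge n) → Dec (EdgeWithin S e)
edgeWithin? S (u , v) = u ∈? S ×-dec v ∈? S

edgesWithin : Subset n → List (Edge n) → ℕ
edgesWithin S es = length (filter (edgeWithin? S) es)

tailsWithin : Subset n → List (Edge n) → ℕ
tailsWithin S fs = length (filter ((_∈? S) ∘ proj₁) fs)

Closed : Subset n → List (Edge n) → Set
Closed S = All (λ (u , v) → u ∈ S → v ∈ S)

∑∈-outdeg : (S : Subset n) (fs : List (Edge n)) → ∑∈ S (outdeg fs) ≡ tailsWithin S fs
∑∈-outdeg S []             = ∑∈-const S 0
∑∈-outdeg S ((t , _) ∷ fs) with t ∈? S
... | yes t∈S = trans (∑∈-+ S (δ t) (outdeg fs)) (cong₂ ℕ._+_ (∑∈-δ-∈ t∈S) (∑∈-outdeg S fs))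
... | no  t∉S = trans (∑∈-+ S (δ t) (outdeg fs)) (cong₂ ℕ._+_ (∑∈-δ-∉ t∉S) (∑∈-outdeg S fs))

edgesWithin≤tailsWithin : (S : Subset n) (fs : List (Edge n)) → edgesWithin S fs ≤ tailsWithin S fs
edgesWithin≤tailsWithin S []             = z≤n
edgesWithin≤tailsWithin S ((u , v) ∷ fs) with u ∈? S | v ∈? S
... | yes _ | yes _ = s≤s (edgesWithin≤tailsWithin S fs)
... | yes _ | no  _ = ℕ.m≤n⇒m≤1+n (edgesWithin≤tailsWithin S fs)
... | no  _ | _     = edgesWithin≤tailsWithin S fs

tailsWithin≤edgesWithin : (S : Subset n) {fs : List (Edge n)} → Closed S fs →
  tailsWithin S fs ≤ edgesWithin S fs
tailsWithin≤edgesWithin S []                           = z≤n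
tailsWithin≤edgesWithin S {(u , v) ∷ fs} (closed ∷ cl) with u ∈? S | v ∈? S
... | yes _   | yes _   = s≤s (tailsWithin≤edgesWithin S cl)
... | yes u∈S | no  v∉S = contradiction (closed u∈S) v∉S
... | no  _   | _       = tailsWithin≤edgesWithin S cl

edgesWithin-orientation : (S : Subset n) {es fs : List (Edge n)} → Orientation es fs →
  edgesWithin S fs ≡ edgesWithin S es
edgesWithin-orientation S [] = refl
edgesWithin-orientation S {(u , v) ∷ _} (inj₁ refl ∷ o) with u ∈? S | v ∈? S
... | yes _ | yes _ = cong suc (edgesWithin-orientation S o)
... | yes _ | no  _ = edgesWithin-orientation S o
... | no  _ | _     = edgesWithin-orientation S o
edgesWithin-orientation S {(u , v) ∷ _} (inj₂ refl ∷ o) with u ∈? S | v ∈? S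
... | yes _ | yes _ = cong suc (edgesWithin-orientation S o)
... | yes _ | no  _ = edgesWithin-orientation S o
... | no  _ | yes _ = edgesWithin-orientation S o
... | no  _ | no  _ = edgesWithin-orientation S o

Sparse : ℕ → List (Edge n) → Set
Sparse {n} c es = ∀ (S : Subset n) → 0 < ∣ S ∣ → edgesWithin S es ≤ c ℕ.* ∣ S ∣

orientable⇒sparse : {c : ℕ} {es : List (Edge n)} → Orientable c es → Sparse c es
orientable⇒sparse {c = c} {es} (fs , o , bounded) S _ = begin
  edgesWithin S es   ≡⟨ edgesWithin-orientation S o ⟨
  edgesWithin S fs   ≤⟨ edgesWithin≤tailsWithin S fs ⟩
  tailsWithin S fs   ≡⟨ ∑∈-outdeg S fs ⟨
  ∑∈ S (outdeg fs)   ≤⟨ ∑∈-mono S (λ _ → bounded _) ⟩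
  ∑∈ S (λ _ → c)     ≡⟨ ∑∈-const S c ⟩
  c ℕ.* ∣ S ∣        ∎
  where open ℕ.≤-Reasoning

closed-saturated⇒dense : {c : ℕ} {R : Subset n} {os : List (Edge n)} {x : Fin n} →
  Closed R os → x ∈ R → (∀ {y} → y ∈ R → c ≤ outdeg os y) → c < outdeg os x →
  c ℕ.* ∣ R ∣ < edgesWithin R os
closed-saturated⇒dense {c = c} {R} {os} closed x∈R saturated overloaded = begin-strict
  c ℕ.* ∣ R ∣        ≡⟨ ∑∈-const R c ⟨
  ∑∈ R (λ _ → c)     <⟨ ∑∈-mono-< saturated x∈R overloaded ⟩
  ∑∈ R (outdeg os)   ≡⟨ ∑∈-outdeg R os ⟩
  tailsWithin R os   ≤⟨ tailsWithin≤edgesWithin R closed ⟩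
  edgesWithin R os   ∎
  where open ℕ.≤-Reasoning

-- Hakimi's theorem

-- f is g with one unit moved from x to y, stated without subtraction.
record Transfer (x y : Fin n) (g f : Fin n → ℕ) : Set where
  constructor transfer
  field shift : ∀ v → f v ℕ.+ δ x v ≡ g v ℕ.+ δ y v

transfer-refl : (x : Fin n) (g : Fin n → ℕ) → Transfer x x g g
transfer-refl x g = transfer (λ _ → refl)

transfer-trans : {x y z : Fin n} {g f h : Fin n → ℕ} →
  Transfer x y g f → Transfer y z f h → Transfer x z g h
transfer-trans {x = x} {y} {z} {g} {f} {h} (transfer g→f) (transfer f→h) =
  transfer λ v → ℕ.+-cancelʳ-≡ (δ y v) _ _ (begin
    h v ℕ.+ δ x v ℕ.+ δ y v   ≡⟨ xy∙z≈xz∙y (h v) (δ x v) (δ y v) ⟩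
    h v ℕ.+ δ y v ℕ.+ δ x v   ≡⟨ cong (ℕ._+ δ x v) (f→h v) ⟩
    f v ℕ.+ δ z v ℕ.+ δ x v   ≡⟨ xy∙z≈xz∙y (f v) (δ z v) (δ x v) ⟩
    f v ℕ.+ δ x v ℕ.+ δ z v   ≡⟨ cong (ℕ._+ δ z v) (g→f v) ⟩
    g v ℕ.+ δ y v ℕ.+ δ z v   ≡⟨ xy∙z≈xz∙y (g v) (δ y v) (δ z v) ⟩
    g v ℕ.+ δ z v ℕ.+ δ y v   ∎)
  where open ≡-Reasoning

transfer-bounded : {x y : Fin n} {g f : Fin n → ℕ} {c : ℕ} → Transfer x y g f →
  g y < c → (∀ v → g v ≤ δ x v ℕ.+ c) → ∀ v → f v ≤ c
transfer-bounded {x = x} {y} {g} {f} {c} (transfer g→f) gy<c g≤δx+c v with v Fin.≟ y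
... | yes refl = begin
  f v                ≤⟨ ℕ.m≤m+n (f v) (δ x v) ⟩
  f v ℕ.+ δ x v      ≡⟨ g→f v ⟩
  g v ℕ.+ δ v v      ≡⟨ cong (g v ℕ.+_) (δ-refl v) ⟩
  g v ℕ.+ 1          ≡⟨ ℕ.+-comm (g v) 1 ⟩
  suc (g v)          ≤⟨ gy<c ⟩
  c                  ∎
  where open ℕ.≤-Reasoning
... | no v≢y = ℕ.+-cancelʳ-≤ (δ x v) (f v) c (begin
  f v ℕ.+ δ x v      ≡⟨ g→f v ⟩
  g v ℕ.+ δ y v      ≡⟨ cong (g v ℕ.+_) (δ-≢ (v≢y ∘ sym)) ⟩
  g v ℕ.+ 0          ≡⟨ ℕ.+-identityʳ (g v) ⟩
  g v                ≤⟨ g≤δx+c v ⟩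
  δ x v ℕ.+ c        ≡⟨ ℕ.+-comm (δ x v) c ⟩
  c ℕ.+ δ x v        ∎)
  where open ℕ.≤-Reasoning

AgreesOutside : Subset n → List (Edge n) → List (Edge n) → Set
AgreesOutside R = Pointwise (λ o f → f ≡ o ⊎ EdgeWithin R o)

edgeWithin-mono : {R R' : Subset n} {e : Edge n} → R ⊆ R' → EdgeWithin R e → EdgeWithin R' e
edgeWithin-mono R⊆R' = Product.map R⊆R' R⊆R'

agreesOutside-mono : {R R' : Subset n} {os fs : List (Edge n)} → R ⊆ R' →
  AgreesOutside R os fs → AgreesOutside R' os fs
agreesOutside-mono R⊆R' = Pointwise.map (Sum.map₂ (edgeWithin-mono R⊆R'))

swap-orients : {e f : Edge n} → f ≡ e ⊎ f ≡ swap e → swap f ≡ e ⊎ swap f ≡ swap e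
swap-orients (inj₁ f≡e)      = inj₂ (cong swap f≡e)
swap-orients (inj₂ f≡swap-e) = inj₁ (cong swap f≡swap-e)

reverse-exit : {R R' : Subset n} {y z : Fin n} {es os fs : List (Edge n)} →
  R ⊆ R' → y ∈ R' → z ∈ R' → z ∉ R → (y , z) ∈ₗ os →
  Orientation es fs → AgreesOutside R os fs →
  ∃[ gs ] (Orientation es gs × AgreesOutside R' os gs × Transfer y z (outdeg fs) (outdeg gs))
reverse-exit R⊆R' y∈R' z∈R' z∉R (Any.here refl) (_ ∷ _) (inj₂ (_ , z∈R) ∷ _) =
  contradiction z∈R z∉R
reverse-exit {y = y} {z} {fs = _ ∷ fs} R⊆R' y∈R' z∈R' z∉R (Any.here refl) (f-orients ∷ o)
             (inj₁ refl ∷ agree) =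
    (z , y) ∷ fs , swap-orients f-orients ∷ o , inj₂ (y∈R' , z∈R') ∷ agreesOutside-mono R⊆R' agree
  , transfer λ v → xy∙z≈zy∙x (δ z v) (outdeg fs v) (δ y v)
reverse-exit {y = y} {z} {fs = (t , h) ∷ fs} R⊆R' y∈R' z∈R' z∉R (Any.there yz∈os) (f-orients ∷ o)
             (f-agrees ∷ agree)
  with gs , o' , agree' , transfer fs→gs ← reverse-exit R⊆R' y∈R' z∈R' z∉R yz∈os o agree =
    (t , h) ∷ gs , f-orients ∷ o' , Sum.map₂ (edgeWithin-mono R⊆R') f-agrees ∷ agree'
  , transfer λ v → begin
      δ t v ℕ.+ outdeg gs v ℕ.+ δ y v     ≡⟨ ℕ.+-assoc (δ t v) (outdeg gs v) (δ y v) ⟩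
      δ t v ℕ.+ (outdeg gs v ℕ.+ δ y v)   ≡⟨ cong (δ t v ℕ.+_) (fs→gs v) ⟩
      δ t v ℕ.+ (outdeg fs v ℕ.+ δ z v)   ≡⟨ ℕ.+-assoc (δ t v) (outdeg fs v) (δ z v) ⟨
      δ t v ℕ.+ outdeg fs v ℕ.+ δ z v     ∎
  where open ≡-Reasoning

Exit : Subset n → Edge n → Set
Exit R (y , z) = y ∈ R × z ∉ R

exit? : (R : Subset n) (e : Edge n) → Dec (Exit R e)
exit? R (y , z) = y ∈? R ×-dec ¬? (z ∈? R)

exit-or-closed : (R : Subset n) (os : List (Edge n)) → Any (Exit R) os ⊎ Closed R os
exit-or-closed R os with Any.any? (exit? R) os
... | yes exit = inj₁ exit
... | no ¬exit = inj₂ (All.map stays (All.¬Any⇒All¬ os ¬exit))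
  where
  stays : ∀ {e} → ¬ Exit R e → proj₁ e ∈ R → proj₂ e ∈ R
  stays {_ , z} ¬exit y∈R with z ∈? R
  ... | yes z∈R = z∈R
  ... | no  z∉R = contradiction (y∈R , z∉R) ¬exit

module AugmentingPaths {es os : List (Edge n)} (c : ℕ) (x : Fin n) where

  -- The effect of reversing, in the orientation os of es, a directed path from x to y
  -- all of whose edges lie inside R; the path itself need not be recorded.
  ReversiblePathTo : Subset n → Fin n → Set
  ReversiblePathTo R y =
    ∃[ fs ] (Orientation es fs × AgreesOutside R os fs × Transfer x y (outdeg os) (outdeg fs))

  Saturated : Subset n → Set
  Saturated R = ∀ {y} → y ∈ R → c ≤ outdeg os y

  Outcome : Set
  Outcome = (∃[ y ] ∃[ R ] (outdeg os y < c × ReversiblePathTo R y))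
          ⊎ (∃[ R ] (x ∈ R × Saturated R × Closed R os))

  reversiblePath-mono : {R R' : Subset n} {y : Fin n} → R ⊆ R' →
    ReversiblePathTo R y → ReversiblePathTo R' y
  reversiblePath-mono R⊆R' (fs , o , agree , os→fs) = fs , o , agreesOutside-mono R⊆R' agree , os→fs

  extend : {R : Subset n} {y z : Fin n} → (y , z) ∈ₗ os → y ∈ R → z ∉ R →
    ReversiblePathTo R y → ReversiblePathTo (R ∪ ⁅ z ⁆) z
  extend {z = z} yz∈os y∈R z∉R (fs , o , agree , os→fs)
    with gs , o' , agree' , fs→gs ← reverse-exit (p⊆p∪q _) (p⊆p∪q _ y∈R) (x∈p∪q⁺ (inj₂ (x∈⁅x⁆ z)))
                                                 z∉R yz∈os o agree
    = gs , o' , agree' , transfer-trans os→fs fs→gs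

  search : (R : Subset n) → Acc _<_ (n ∸ ∣ R ∣) → x ∈ R → Saturated R →
    (∀ {y} → y ∈ R → ReversiblePathTo R y) → Outcome
  search R (acc smaller) x∈R saturated paths with exit-or-closed R os
  ... | inj₂ closed = inj₂ (R , x∈R , saturated , closed)
  ... | inj₁ exit with find exit
  ... | (y , z) , yz∈os , y∈R , z∉R with outdeg os z ℕ.<? c
  ...   | yes room = inj₁ (z , R ∪ ⁅ z ⁆ , room , extend yz∈os y∈R z∉R (paths y∈R))
  ...   | no  full = search (R ∪ ⁅ z ⁆) (smaller grows) (p⊆p∪q _ x∈R) saturated' paths'
    where
    grows : n ∸ ∣ R ∪ ⁅ z ⁆ ∣ < n ∸ ∣ R ∣
    grows = ℕ.∸-monoʳ-< (p⊂q⇒∣p∣<∣q∣ (p⊆p∪q _ , z , x∈p∪q⁺ (inj₂ (x∈⁅x⁆ z)) , z∉R))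
                        (∣p∣≤n (R ∪ ⁅ z ⁆))
    saturated' : Saturated (R ∪ ⁅ z ⁆)
    saturated' w∈R' with x∈p∪q⁻ R ⁅ z ⁆ w∈R'
    ... | inj₁ w∈R = saturated w∈R
    ... | inj₂ w∈z rewrite x∈⁅y⁆⇒x≡y z w∈z = ℕ.≮⇒≥ full
    paths' : ∀ {w} → w ∈ R ∪ ⁅ z ⁆ → ReversiblePathTo (R ∪ ⁅ z ⁆) w
    paths' w∈R' with x∈p∪q⁻ R ⁅ z ⁆ w∈R'
    ... | inj₁ w∈R = reversiblePath-mono (p⊆p∪q _) (paths w∈R)
    ... | inj₂ w∈z rewrite x∈⁅y⁆⇒x≡y z w∈z = extend yz∈os y∈R z∉R (paths y∈R)

  start : Orientation es os → c ≤ outdeg os x → Outcome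
  start os-orients c≤x = search ⁅ x ⁆ (<-wellFounded _) (x∈⁅x⁆ x) saturated₀ paths₀
    where
    saturated₀ : Saturated ⁅ x ⁆
    saturated₀ y∈⁅x⁆ rewrite x∈⁅y⁆⇒x≡y x y∈⁅x⁆ = c≤x
    paths₀ : ∀ {y} → y ∈ ⁅ x ⁆ → ReversiblePathTo ⁅ x ⁆ y
    paths₀ y∈⁅x⁆ rewrite x∈⁅y⁆⇒x≡y x y∈⁅x⁆ =
      os , os-orients , Pointwise.refl (inj₁ refl) , transfer-refl x (outdeg os)

δ-+-bounded : {g : Fin n → ℕ} {u : Fin n} {c : ℕ} → g u < c → (∀ v → g v ≤ c) →
  ∀ v → δ u v ℕ.+ g v ≤ c
δ-+-bounded {u = u} gu<c g≤c v with u Fin.≟ v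
... | yes refl = gu<c
... | no  _    = g≤c v

orientable-∷ : {c : ℕ} {u w : Fin n} {es : List (Edge n)} →
  Sparse c ((u , w) ∷ es) → Orientable c es → Orientable c ((u , w) ∷ es)
orientable-∷ {c = c} {u} {w} {es} sparse (fs , o , bounded) with outdeg fs u ℕ.<? c
... | yes room = (u , w) ∷ fs , inj₁ refl ∷ o , δ-+-bounded room bounded
... | no  full = resolve (start os-orients (ℕ.<⇒≤ u-overloaded))
  where
  os = (u , w) ∷ fs
  os-orients : Orientation ((u , w) ∷ es) os
  os-orients = inj₁ refl ∷ o
  open AugmentingPaths {es = (u , w) ∷ es} {os} c u
  u-overloaded : c < outdeg os u
  u-overloaded = subst (c <_) (cong (ℕ._+ outdeg fs u) (sym (δ-refl u))) (s≤s (ℕ.≮⇒≥ full))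
  resolve : Outcome → Orientable c ((u , w) ∷ es)
  resolve (inj₁ (y , R , y-room , fs' , o' , _ , os→fs')) =
    fs' , o' , transfer-bounded os→fs' y-room (λ v → ℕ.+-monoʳ-≤ (δ u v) (bounded v))
  resolve (inj₂ (R , u∈R , saturated , closed)) =
    contradiction (sparse R (ℕ.≤-<-trans z≤n (x∈p⇒∣p-x∣<∣p∣ u∈R)))
      (ℕ.<⇒≱ (subst (c ℕ.* ∣ R ∣ <_) (edgesWithin-orientation R os-orients)
                     (closed-saturated⇒dense closed u∈R saturated u-overloaded)))

hakimi : {c : ℕ} (es : List (Edge n)) → Sparse c es → Orientable c es
hakimi []             _      = [] , [] , λ _ → z≤n
hakimi {c = c} ((u , w) ∷ es) sparse = orientable-∷ sparse (hakimi es sparse-es)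
  where
  sparse-es : Sparse c es
  sparse-es S pos = ℕ.≤-trans (length-filter-∷ (edgeWithin? S) (u , w) es) (sparse S pos)

-- Rational arithmetic

fromℤ : ℤ → ℚ
fromℤ z = mkℚ z 0 (Coprimality.sym (Coprimality.1-coprimeTo ℤ.∣ z ∣))

≤fromℤ⇔ : (q : ℚ) (z : ℤ) → q ℚ.≤ fromℤ z ⇔ ↥ q ℤ.≤ z ℤ.* ↧ q
≤fromℤ⇔ q z = mk⇔ (λ { (ℚ.*≤* le) → subst (ℤ._≤ z ℤ.* ↧ q) (ℤ.*-identityʳ (↥ q)) le })
                  (λ le → ℚ.*≤* (subst (ℤ._≤ z ℤ.* ↧ q) (sym (ℤ.*-identityʳ (↥ q))) le))

0≤fromℤ+ : (m : ℕ) → 0ℚ ℚ.≤ fromℤ (+ m)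
0≤fromℤ+ m = Equivalence.from (≤fromℤ⇔ 0ℚ (+ m))
                               (subst (0ℤ ℤ.≤_) (sym (ℤ.*-identityʳ (+ m))) (ℤ.+≤+ z≤n))

floor*↧≤↥ : (p : ℚ) → floor p ℤ.* ↧ p ℤ.≤ ↥ p
floor*↧≤↥ p@record{} = ℤ.[n/d]*d≤n (↥ p) (↧ p)

↥<suc[floor]*↧ : (p : ℚ) → ↥ p ℤ.< ℤ.suc (floor p) ℤ.* ↧ p
↥<suc[floor]*↧ (mkℚ n d _) rewrite ℤ.div-pos-is-/ℕ n (suc d) {{_}} = ℤ.n<s[n/ℕd]*d n (suc d)

↥≤ceiling*↧ : (q : ℚ) → ↥ q ℤ.≤ ceiling q ℤ.* ↧ q
↥≤ceiling*↧ q@record{} = begin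
  ↥ q                ≡⟨ ℤ.neg-involutive (↥ q) ⟨
  ℤ.- (ℤ.- ↥ q)      ≤⟨ ℤ.neg-mono-≤ (subst₂ ℤ._≤_ (cong (f ℤ.*_) (ℚ.↧-neg q)) (ℚ.↥-neg q)
                                                  (floor*↧≤↥ (ℚ.- q))) ⟩
  ℤ.- (f ℤ.* ↧ q)    ≡⟨ ℤ.neg-distribˡ-* f (↧ q) ⟩
  ℤ.- f ℤ.* ↧ q      ∎
  where
  open ℤ.≤-Reasoning
  f = floor (ℚ.- q)

ceiling-least : (q : ℚ) (z : ℤ) → ↥ q ℤ.≤ z ℤ.* ↧ q → ceiling q ℤ.≤ z
ceiling-least q@record{} z ↥q≤z↧q = subst (ℤ.- f ℤ.≤_) (ℤ.neg-involutive z) (ℤ.neg-mono-≤ -z≤f)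
  where
  f = floor (ℚ.- q)
  -z↧<suc[f]↧ : ℤ.- z ℤ.* ↧ q ℤ.< ℤ.suc f ℤ.* ↧ q
  -z↧<suc[f]↧ = begin-strict
    ℤ.- z ℤ.* ↧ q          ≡⟨ ℤ.neg-distribˡ-* z (↧ q) ⟨
    ℤ.- (z ℤ.* ↧ q)        ≤⟨ ℤ.neg-mono-≤ ↥q≤z↧q ⟩
    ℤ.- ↥ q                ≡⟨ ℚ.↥-neg q ⟨
    ↥ (ℚ.- q)              <⟨ ↥<suc[floor]*↧ (ℚ.- q) ⟩
    ℤ.suc f ℤ.* ↧ (ℚ.- q)  ≡⟨ cong (ℤ.suc f ℤ.*_) (ℚ.↧-neg q) ⟩
    ℤ.suc f ℤ.* ↧ q        ∎
    where open ℤ.≤-Reasoning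
  -z≤f : ℤ.- z ℤ.≤ f
  -z≤f = subst₂ ℤ._≤_ (ℤ.pred-suc (ℤ.- z)) (ℤ.pred-suc f)
           (ℤ.pred-mono (ℤ.i<j⇒suc[i]≤j
             (ℤ.*-cancelʳ-<-nonNeg {i = ℤ.- z} {j = ℤ.suc f} (↧ q) -z↧<suc[f]↧)))

ceiling≤⇔ : (q : ℚ) (z : ℤ) → ceiling q ℤ.≤ z ⇔ q ℚ.≤ fromℤ z
ceiling≤⇔ q@record{} z = mk⇔
  (λ ⌈q⌉≤z → Equivalence.from (≤fromℤ⇔ q z)
               (ℤ.≤-trans (↥≤ceiling*↧ q) (ℤ.*-monoʳ-≤-nonNeg (↧ q) ⌈q⌉≤z)))
  (λ q≤z → ceiling-least q z (Equivalence.to (≤fromℤ⇔ q z) q≤z))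

ceiling-nonNeg : (q : ℚ) → 0ℚ ℚ.≤ q → ∃[ c ] ceiling q ≡ + c
ceiling-nonNeg q 0≤q with ceiling q in ⌈q⌉≡
... | + c        = c , refl
... | ℤ.-[1+ m ]
  with ℚ.*≤* () ← ℚ.≤-trans 0≤q (Equivalence.to (ceiling≤⇔ q ℤ.-[1+ m ]) (ℤ.≤-reflexive ⌈q⌉≡))

*½≤⇔ : (q : ℚ) (c : ℕ) → q * ½ ℚ.≤ fromℤ (+ c) ⇔ q ℚ.≤ fromℤ (+ (2 ℕ.* c))
*½≤⇔ q@(mkℚ a d _) c = mk⇔ to from
  where
  q*½≃ : ℚ.toℚᵘ (q * ½) ℚᵘ.≃ ℚ.toℚᵘ q ℚᵘ.* ℚ.toℚᵘ ½
  q*½≃ = ℚ.toℚᵘ-homo-* q ½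
  reorder : ∀ c d → c ℕ.* (d ℕ.* 2) ≡ 2 ℕ.* c ℕ.* d
  reorder = solve-∀
  cross : + c ℤ.* + (suc d ℕ.* 2) ≡ + (2 ℕ.* c) ℤ.* + suc d
  cross = trans (sym (ℤ.pos-* c _)) (trans (cong +_ (reorder c (suc d))) (ℤ.pos-* (2 ℕ.* c) (suc d)))
  to : q * ½ ℚ.≤ fromℤ (+ c) → q ℚ.≤ fromℤ (+ (2 ℕ.* c))
  to le with ℚᵘ.*≤* le' ← ℚᵘ.≤-respˡ-≃ q*½≃ (ℚ.toℚᵘ-mono-≤ le) =
    ℚ.*≤* (subst₂ ℤ._≤_ (ℤ.*-identityʳ (a ℤ.* + 1)) cross le')
  from : q ℚ.≤ fromℤ (+ (2 ℕ.* c)) → q * ½ ℚ.≤ fromℤ (+ c)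
  from (ℚ.*≤* le) = ℚ.toℚᵘ-cancel-≤ (ℚᵘ.≤-respˡ-≃ (ℚᵘ.≃-sym q*½≃)
    (ℚᵘ.*≤* (subst₂ ℤ._≤_ (sym (ℤ.*-identityʳ (a ℤ.* + 1))) (sym cross) le)))

avgDeg≤⇔ : (e s c : ℕ) → avgDeg e (suc s) ℚ.≤ fromℤ (+ (2 ℕ.* c)) ⇔ e ≤ c ℕ.* suc s
avgDeg≤⇔ e s c = mk⇔ to from
  where
  avg≃ : ℚ.toℚᵘ (avgDeg e (suc s)) ℚᵘ.≃ ℚᵘ.mkℚᵘ (+ (2 ℕ.* e)) s
  avg≃ = ℚ.toℚᵘ-fromℚᵘ _
  lhs : + (2 ℕ.* e) ℤ.* + 1 ≡ + (2 ℕ.* e)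
  lhs = ℤ.*-identityʳ (+ (2 ℕ.* e))
  rhs : + (2 ℕ.* c) ℤ.* + suc s ≡ + (2 ℕ.* (c ℕ.* suc s))
  rhs = trans (sym (ℤ.pos-* (2 ℕ.* c) (suc s))) (cong +_ (ℕ.*-assoc 2 c (suc s)))
  to : avgDeg e (suc s) ℚ.≤ fromℤ (+ (2 ℕ.* c)) → e ≤ c ℕ.* suc s
  to le with ℚᵘ.*≤* le' ← ℚᵘ.≤-respˡ-≃ avg≃ (ℚ.toℚᵘ-mono-≤ le) =
    ℕ.*-cancelˡ-≤ 2 (ℤ.drop‿+≤+ (subst₂ ℤ._≤_ lhs rhs le'))
  from : e ≤ c ℕ.* suc s → avgDeg e (suc s) ℚ.≤ fromℤ (+ (2 ℕ.* c))
  from le = ℚ.toℚᵘ-cancel-≤ (ℚᵘ.≤-respˡ-≃ (ℚᵘ.≃-sym avg≃)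
    (ℚᵘ.*≤* (subst₂ ℤ._≤_ (sym lhs) (sym rhs) (ℤ.+≤+ (ℕ.*-monoʳ-≤ 2 le)))))

-- Maximum average degree

≤-foldr-⊔ : {x : ℚ} {xs : List ℚ} → x ∈ₗ xs → x ℚ.≤ List.foldr _⊔_ 0ℚ xs
≤-foldr-⊔ {xs = y ∷ ys} (Any.here refl)  = ℚ.p≤p⊔q y _
≤-foldr-⊔ {xs = y ∷ ys} (Any.there x∈ys) = ℚ.≤-trans (≤-foldr-⊔ x∈ys) (ℚ.p≤q⊔p y _)

foldr-⊔-least : {b : ℚ} (xs : List ℚ) → 0ℚ ℚ.≤ b → (∀ {x} → x ∈ₗ xs → x ℚ.≤ b) →
  List.foldr _⊔_ 0ℚ xs ℚ.≤ b
foldr-⊔-least []       0≤b _  = 0≤b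
foldr-⊔-least (y ∷ ys) 0≤b ≤b = ℚ.⊔-lub (≤b (Any.here refl)) (foldr-⊔-least ys 0≤b (≤b ∘ Any.there))

0≤foldr-⊔ : (xs : List ℚ) → 0ℚ ℚ.≤ List.foldr _⊔_ 0ℚ xs
0≤foldr-⊔ []       = ℚ.≤-refl
0≤foldr-⊔ (y ∷ ys) = ℚ.≤-trans (0≤foldr-⊔ ys) (ℚ.p≤q⊔p y _)

countTrue≡∣∣ : (S : Subset n) → countTrue S ≡ ∣ S ∣
countTrue≡∣∣ []            = refl
countTrue≡∣∣ (inside  ∷ S) = cong suc (countTrue≡∣∣ S)
countTrue≡∣∣ (outside ∷ S) = countTrue≡∣∣ S

∈-allSubsets : (m : ℕ) (b : Vec Bool m) → b ∈ₗ allSubsets m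
∈-allSubsets zero    []          = Any.here refl
∈-allSubsets (suc m) (true  ∷ b) = ∈-++⁺ˡ (∈-map⁺ (true ∷_) (∈-allSubsets m b))
∈-allSubsets (suc m) (false ∷ b) =
  ∈-++⁺ʳ (map (true ∷_) (allSubsets m)) (∈-map⁺ (false ∷_) (∈-allSubsets m b))

T-lookup⇔∈ : {S : Subset n} {u : Fin n} → T (lookup S u) ⇔ u ∈ S
T-lookup⇔∈ {S = S} {u} =
  mk⇔ (Vec.lookup⇒[]= u S ∘ Equivalence.to T-≡) (Equivalence.from T-≡ ∘ Vec.[]=⇒lookup)

T-isSubgraph⇔ : (G : SimpleGraph n) (S : Subset n) (F : Vec Bool (length (edges G))) →
  T (isSubgraph G S F) ⇔ All (EdgeWithin S) (selected (edges G) F)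
T-isSubgraph⇔ G S F =
  mk⇔ (All.map (Equivalence.to within⇔) ∘ All.all⁺ _ _) (All.all⁻ _ ∘ All.map (Equivalence.from within⇔))
  where
  within⇔ : {e : Edge _} → T (lookup S (proj₁ e) ∧ lookup S (proj₂ e)) ⇔ EdgeWithin S e
  within⇔ = ⇔-trans T-∧ (T-lookup⇔∈ ×-⇔ T-lookup⇔∈)

-- avgDegrees G is concatMap (λ S → subgraphAvgDegrees G S (countTrue S)) (allSubsets n);
-- abstracting the size k lets membership be analysed by matching on k.
subgraphAvgDegrees : SimpleGraph n → Subset n → ℕ → List ℚ
subgraphAvgDegrees G S k =
  if 0 ℕ.<ᵇ k
  then map (λ F → avgDeg (length (selected (edges G) F)) k)
           (List.filterᵇ (isSubgraph G S) (allSubsets (length (edges G))))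
  else []

∈-avgDegrees⁺ : (G : SimpleGraph n) (S : Subset n) (F : Vec Bool (length (edges G))) →
  0 < countTrue S → T (isSubgraph G S F) →
  avgDeg (length (selected (edges G) F)) (countTrue S) ∈ₗ avgDegrees G
∈-avgDegrees⁺ {n} G S F pos sub =
  ∈-concatMap⁺ (λ S → subgraphAvgDegrees G S (countTrue S)) (lose (∈-allSubsets n S) (sized⁺ pos))
  where
  sized⁺ : ∀ {k} → 0 < k → avgDeg (length (selected (edges G) F)) k ∈ₗ subgraphAvgDegrees G S k
  sized⁺ {suc _} _ = ∈-map⁺ _ (∈-filter⁺ (T? ∘ isSubgraph G S) (∈-allSubsets _ F) sub)

∈-avgDegrees⁻ : (G : SimpleGraph n) {x : ℚ} → x ∈ₗ avgDegrees G →
  ∃[ S ] ∃[ F ] ∃[ s ] (countTrue S ≡ suc s × T (isSubgraph G S F) ×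
                        x ≡ avgDeg (length (selected (edges G) F)) (suc s))
∈-avgDegrees⁻ {n} G x∈ =
  let S , _ , x∈S = find (∈-concatMap⁻ (λ S → subgraphAvgDegrees G S (countTrue S)) {xs = allSubsets n} x∈)
  in S , sized S (countTrue S) refl x∈S
  where
  sized : ∀ {x} S k → countTrue S ≡ k → x ∈ₗ subgraphAvgDegrees G S k →
    ∃[ F ] ∃[ s ] (countTrue S ≡ suc s × T (isSubgraph G S F) ×
                   x ≡ avgDeg (length (selected (edges G) F)) (suc s))
  sized S zero    _    ()
  sized S (suc s) ∣S∣≡ x∈S =
    let F , F∈ , x≡ = ∈-map⁻ (λ F → avgDeg (length (selected (edges G) F)) (suc s)) x∈S
        sub = proj₂ (∈-filter⁻ (T? ∘ isSubgraph G S) {xs = allSubsets (length (edges G))} F∈)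
    in F , s , ∣S∣≡ , sub , x≡

mad≤⇔sparse : (G : SimpleGraph n) (c : ℕ) → mad G ℚ.≤ fromℤ (+ (2 ℕ.* c)) ⇔ Sparse c (edges G)
mad≤⇔sparse G c = mk⇔ (λ mad≤ S → mad≤⇒sparse mad≤ S ∣ S ∣ refl) sparse⇒mad≤
  where
  es = edges G
  mad≤⇒sparse : mad G ℚ.≤ fromℤ (+ (2 ℕ.* c)) → ∀ S k → ∣ S ∣ ≡ k → 0 < k → edgesWithin S es ≤ c ℕ.* k
  mad≤⇒sparse mad≤ S (suc s) ∣S∣≡ _ =
    Equivalence.to (avgDeg≤⇔ (edgesWithin S es) s c) (ℚ.≤-trans (≤-foldr-⊔ within∈) mad≤)
    where
    F = indicator (edgeWithin? S) es
    countTrue≡ : countTrue S ≡ suc s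
    countTrue≡ = trans (countTrue≡∣∣ S) ∣S∣≡
    within∈ : avgDeg (edgesWithin S es) (suc s) ∈ₗ avgDegrees G
    within∈ = subst₂ (λ e k → avgDeg e k ∈ₗ avgDegrees G)
      (cong length (selected-indicator (edgeWithin? S) es)) countTrue≡
      (∈-avgDegrees⁺ G S F (subst (0 <_) (sym countTrue≡) (s≤s z≤n))
        (Equivalence.from (T-isSubgraph⇔ G S F)
          (subst (All (EdgeWithin S)) (sym (selected-indicator (edgeWithin? S) es))
                 (All.all-filter (edgeWithin? S) es))))
  sparse⇒mad≤ : Sparse c es → mad G ℚ.≤ fromℤ (+ (2 ℕ.* c))
  sparse⇒mad≤ sparse = foldr-⊔-least (avgDegrees G) (0≤fromℤ+ (2 ℕ.* c)) bounded
    where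
    bounded : ∀ {x} → x ∈ₗ avgDegrees G → x ℚ.≤ fromℤ (+ (2 ℕ.* c))
    bounded x∈ =
      let S , F , s , countTrue≡ , sub , x≡ = ∈-avgDegrees⁻ G x∈
          ∣S∣≡ = trans (sym (countTrue≡∣∣ S)) countTrue≡
      in subst (ℚ._≤ fromℤ (+ (2 ℕ.* c))) (sym x≡) (Equivalence.from (avgDeg≤⇔ _ s c) (ℕ.≤-trans
           (length-selected≤ (edgeWithin? S) es F (Equivalence.to (T-isSubgraph⇔ G S F) sub))
           (subst (λ k → edgesWithin S es ≤ c ℕ.* k) ∣S∣≡
                  (sparse S (subst (0 <_) (sym ∣S∣≡) (s≤s z≤n))))))

sparse⇔ceiling≤ : (G : SimpleGraph n) (c : ℕ) → Sparse c (edges G) ⇔ ceiling (mad G * ½) ℤ.≤ + c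
sparse⇔ceiling≤ G c =
  ⇔-sym (⇔-trans (ceiling≤⇔ (mad G * ½) (+ c)) (⇔-trans (*½≤⇔ (mad G) c) (mad≤⇔sparse G c)))

corollary4p2 : ∀ (n : ℕ) (G : SimpleGraph (suc n)) →
    ∃[ k ] (IsAT G allNegative k × (+ k ≡ ceiling (mad G * ½) + 1ℤ))
corollary4p2 n G
  with c , ⌈mad/2⌉≡c ← ceiling-nonNeg (mad G * ½) (ℚ.*-monoʳ-≤-nonNeg ½ (0≤foldr-⊔ (avgDegrees G)))
  = suc c , (hasAT , minimal) , trans (cong +_ (ℕ.+-comm 1 c)) (cong (_+ 1ℤ) (sym ⌈mad/2⌉≡c))
  where
  hasAT : HasATMonomial G allNegative (suc c)
  hasAT = Equivalence.to (orientable⇔hasATMonomial G c)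
            (hakimi (edges G) (Equivalence.from (sparse⇔ceiling≤ G c) (ℤ.≤-reflexive ⌈mad/2⌉≡c)))
  minimal : ∀ j → j < suc c → ¬ HasATMonomial G allNegative j
  minimal zero    _         = ¬hasATMonomial-zero G allNegative
  minimal (suc j) (s≤s j<c) hasAT-j = ℕ.<⇒≱ j<c (ℤ.drop‿+≤+ (subst (ℤ._≤ + j) ⌈mad/2⌉≡c
    (Equivalence.to (sparse⇔ceiling≤ G j)
      (orientable⇒sparse (Equivalence.from (orientable⇔hasATMonomial G j) hasAT-j)))))
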